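{- Let $(A,B)$ be an invertible Jones pair of $n\times n$ matrices with $A$ symmetric. Then the space $\mathcal B=\{\mathcal M(F,G,H) : F\in\mathcal N_A,\ G,H\in\mathcal N_{A,B}\}$ contains $I_{4n}$ and $J_{4n}$.
   Context: All matrices are complex. $X\circ Y$ is the Schur product; $X^{(-)}$ is the Schur inverse of a matrix with no zero entries; $J_m$ is the $m\times m$ all-ones matrix. $W$ ($n\times n$) is type-II if $W(W^{(-)})^T=nI$. For a matrix $C$, $X_C(M)=CM$, $\Delta_C(M)=C\circ M$. A Jones pair is a pair $(A,B)$ of $n\times n$ matrices with $X_A$, $\Delta_B$ invertible, $X_A\Delta_BX_A=\Delta_BX_A\Delta_B$ and $X_A\Delta_{B^T}X_A=\Delta_{B^T}X_A\Delta_{B^T}$; it is invertible if moreover $A$ has no zero entry and $B$ is invertible (equivalently $A,B$ type-II). With $e_1,\dots,e_n$ the standard basis, for $P$ invertible and $Q$ without zero entries, $\mathcal N_{P,Q}$ is the set of matrices $M$ such that every $Pe_i\circ Qe_j$ is an eigenvector of $M$, and $\Theta_{P,Q}(M)$ is the matrix with $M(Pe_i\circ Qe_j)=\Theta_{P,Q}(M)_{ij}(Pe_i\circ Qe_j)$. For type-II $P$, $\mathcal N_P:=\mathcal N_{P,P^{(-)}}$, $\Theta_P:=\Theta_{P,P^{(-)}}$. Standing facts for the definitions: $\mathcal N_{A,B}=\mathcal N_{A,B^T}$ is closed under transposition and $\mathcal N_A=\mathcal N_{B^{(-)}}$. Pairing: for $H\in\mathcal N_{A,B}$, the matrix paired with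 $H$ is the unique $K$ with $K^T\in\mathcal N_{A,B^T}$ and $\Theta_{A,B}(H)=\Theta_{A,B^T}(K^T)^T$. For $F\in\mathcal N_A$, $G,H\in\mathcal N_{A,B}$, with $K$ paired with $H$, \[ \mathcal M(F,G,H)=\begin{pmatrix} \Theta_A(F)+H & \Theta_A(F)-H & \Theta_{A,B}(G) & \Theta_{A,B}(G)\\ \Theta_A(F)-H & \Theta_A(F)+H & \Theta_{A,B}(G) & \Theta_{A,B}(G)\\ \Theta_{A,B}(G^T)^T & \Theta_{A,B}(G^T)^T & \Theta_{B^{(-)}}(F)+K & \Theta_{B^{(-)}}(F)-K\\ \Theta_{A,B}(G^T)^T & \Theta_{A,B}(G^T)^T & \Theta_{B^{(-)}}(F)-K & \Theta_{B^{(-)}}(F)+K \end{pmatrix}. \] -}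

module Defs where

open import Level using (Level; _⊔_)
open import Data.Nat using (ℕ; zero; suc)
open import Data.Fin using (Fin; zero; suc; _≟_)
open import Data.Product using (Σ; ∃; _×_; _,_)
open import Relation.Nullary using (¬_; yes; no)
open import Algebra.Bundles using (CommutativeRing)

record Field c ℓ : Set (Level.suc (c ⊔ ℓ)) where
  field
    commutativeRing : CommutativeRing c ℓ
  open CommutativeRing commutativeRing public
    using (Carrier; _≈_; _+_; _*_; -_; _-_; 0#; 1#; setoid; isCommutativeRing)
  field
    _⁻¹        : Carrier → Carrier
    ⁻¹-inverse : ∀ x → ¬ (x ≈ 0#) → (x * (x ⁻¹)) ≈ 1#
    0≉1        : ¬ (0# ≈ 1#)

  natCast : ℕ → Carrier
  natCast zero    = 0#
  natCast (suc m) = 1# + natCast m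

  pow : Carrier → ℕ → Carrier
  pow x zero    = 1#
  pow x (suc m) = x * pow x m

  ∑ : ∀ {m} → (Fin m → Carrier) → Carrier
  ∑ {zero}  f = 0#
  ∑ {suc m} f = f zero + ∑ (λ i → f (suc i))

-- An algebraically closed field of characteristic zero
-- (stands in for ℂ).
record ACF0 c ℓ : Set (Level.suc (c ⊔ ℓ)) where
  field
    field′ : Field c ℓ
  open Field field′ public
  field
    char0     : ∀ m → ¬ (natCast (suc m) ≈ 0#)
    algClosed : ∀ (d : ℕ) (a : Fin (suc d) → Carrier) →
                ∃ λ x → (pow x (suc d) + ∑ (λ k → a k * pow x (Data.Fin.toℕ k))) ≈ 0#

module Theory {c ℓ} (K : ACF0 c ℓ) where
  open ACF0 K public

  Vector : ℕ → Set c
  Vector n = Fin n → Carrier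

  Matrix : ℕ → Set c
  Matrix n = Fin n → Fin n → Carrier

  _≈v_ : ∀ {n} → Vector n → Vector n → Set ℓ
  u ≈v v = ∀ i → u i ≈ v i

  _≈m_ : ∀ {n} → Matrix n → Matrix n → Set ℓ
  M ≈m N = ∀ i j → M i j ≈ N i j

  δ : ∀ {n} → Fin n → Fin n → Carrier
  δ i j with i ≟ j
  ... | yes _ = 1#
  ... | no  _ = 0#

  I : ∀ {n} → Matrix n
  I = δ

  J : ∀ {n} → Matrix n
  J _ _ = 1#

  O : ∀ {n} → Matrix n
  O _ _ = 0#

  _ᵀ : ∀ {n} → Matrix n → Matrix n
  (M ᵀ) i j = M j i

  _·_ : ∀ {n} → Matrix n → Matrix n → Matrix n
  (M · N) i j = ∑ (λ k → M i k * N k j)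

  _·v_ : ∀ {n} → Matrix n → Vector n → Vector n
  (M ·v v) i = ∑ (λ k → M i k * v k)

  _*v_ : ∀ {n} → Carrier → Vector n → Vector n
  (a *v v) i = a * v i

  _*m_ : ∀ {n} → Carrier → Matrix n → Matrix n
  (a *m M) i j = a * M i j

  _+m_ : ∀ {n} → Matrix n → Matrix n → Matrix n
  (M +m N) i j = M i j + N i j

  _-m_ : ∀ {n} → Matrix n → Matrix n → Matrix n
  (M -m N) i j = M i j - N i j

  _∘_ : ∀ {n} → Matrix n → Matrix n → Matrix n
  (M ∘ N) i j = M i j * N i j

  _∘v_ : ∀ {n} → Vector n → Vector n → Vector n
  (u ∘v v) i = u i * v i

  -- Schur inverse (meaningful when the matrix has no zero entry)
  _⁽⁻⁾ : ∀ {n} → Matrix n → Matrix n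
  (M ⁽⁻⁾) i j = M i j ⁻¹

  col : ∀ {n} → Matrix n → Fin n → Vector n
  col P i k = P k i

  NoZeroEntry : ∀ {n} → Matrix n → Set ℓ
  NoZeroEntry M = ∀ i j → ¬ (M i j ≈ 0#)

  InvertibleMatrix : ∀ {n} → Matrix n → Set (c ⊔ ℓ)
  InvertibleMatrix {n} M = Σ (Matrix n) λ N → ((M · N) ≈m I) × ((N · M) ≈m I)

  TypeII : ∀ {n} → Matrix n → Set ℓ
  TypeII {n} W = NoZeroEntry W × ((W · ((W ⁽⁻⁾) ᵀ)) ≈m (natCast n *m I))

  InvertibleMap : ∀ {n} → (Matrix n → Matrix n) → Set (c ⊔ ℓ)
  InvertibleMap {n} f =
    Σ (Matrix n → Matrix n) λ g →
      (∀ M → f (g M) ≈m M) × (∀ M → g (f M) ≈m M)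

  X : ∀ {n} → Matrix n → Matrix n → Matrix n
  X C M = C · M

  Δ : ∀ {n} → Matrix n → Matrix n → Matrix n
  Δ C M = C ∘ M

  record JonesPair {n} (A B : Matrix n) : Set (c ⊔ ℓ) where
    field
      X-inv  : InvertibleMap (X A)
      Δ-inv  : InvertibleMap (Δ B)
      braid  : ∀ M → X A (Δ B (X A M)) ≈m Δ B (X A (Δ B M))
      braidᵀ : ∀ M → X A (Δ (B ᵀ) (X A M)) ≈m Δ (B ᵀ) (X A (Δ (B ᵀ) M))

  record InvertibleJonesPair {n} (A B : Matrix n) : Set (c ⊔ ℓ) where
    field
      jonesPair : JonesPair A B
      A-noZero  : NoZeroEntry A
      B-inv     : InvertibleMatrix B

  eig : ∀ {n} → Matrix n → Matrix n → Fin n → Fin n → Vector n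
  eig P Q i j = col P i ∘v col Q j

  -- IsΘ P Q M T :  M (P e_i ∘ Q e_j) = T_ij (P e_i ∘ Q e_j) for all i j,
  -- i.e. M ∈ 𝒩_{P,Q} and T = Θ_{P,Q}(M) (T is unique since the vectors
  -- P e_i ∘ Q e_j are nonzero for P invertible and Q without zero entries).
  IsΘ : ∀ {n} → Matrix n → Matrix n → Matrix n → Matrix n → Set ℓ
  IsΘ P Q M T = ∀ i j → (M ·v eig P Q i j) ≈v (T i j *v eig P Q i j)

  InN : ∀ {n} → Matrix n → Matrix n → Matrix n → Set (c ⊔ ℓ)
  InN {n} P Q M = ∀ i j → Σ Carrier λ θ → (M ·v eig P Q i j) ≈v (θ *v eig P Q i j)

  -- 4×4 block matrices with n×n blocks (a 4n×4n matrix)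
  BlockMatrix : ℕ → Set c
  BlockMatrix n = Fin 4 → Fin 4 → Matrix n

  _≈b_ : ∀ {n} → BlockMatrix n → BlockMatrix n → Set ℓ
  M ≈b N = ∀ r s → M r s ≈m N r s

  I₄ₙ : ∀ {n} → BlockMatrix n
  I₄ₙ r s with r ≟ s
  ... | yes _ = I
  ... | no  _ = O

  J₄ₙ : ∀ {n} → BlockMatrix n
  J₄ₙ _ _ = J

  -- the block matrix 𝓜 built from
  --   T₁ = Θ_A(F), T₂ = Θ_{A,B}(G), T₃ = Θ_{A,B}(Gᵀ), T₄ = Θ_{B⁽⁻⁾}(F), H, K
  blocks : ∀ {n} → (T₁ T₂ T₃ T₄ H K : Matrix n) → BlockMatrix n
  blocks T₁ T₂ T₃ T₄ H K = λ where
    zero zero → T₁ +m H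
    zero (suc zero) → T₁ -m H
    zero (suc (suc _)) → T₂
    (suc zero) zero → T₁ -m H
    (suc zero) (suc zero) → T₁ +m H
    (suc zero) (suc (suc _)) → T₂
    (suc (suc _)) zero → T₃ ᵀ
    (suc (suc _)) (suc zero) → T₃ ᵀ
    (suc (suc zero)) (suc (suc zero)) → T₄ +m K
    (suc (suc zero)) (suc (suc (suc _))) → T₄ -m K
    (suc (suc (suc _))) (suc (suc zero)) → T₄ -m K
    (suc (suc (suc _))) (suc (suc (suc _))) → T₄ +m K

  -- Membership of a 4n×4n matrix in  ℬ = { 𝓜(F,G,H) : F ∈ 𝒩_A, G,H ∈ 𝒩_{A,B} }.
  -- Θ-values are given as witnesses (they are uniquely determined), and K is
  -- the matrix paired with H: Kᵀ ∈ 𝒩_{A,Bᵀ} and Θ_{A,B}(H) = Θ_{A,Bᵀ}(Kᵀ)ᵀ.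
  Inℬ : ∀ {n} → Matrix n → Matrix n → BlockMatrix n → Set (c ⊔ ℓ)
  Inℬ {n} A B N =
    Σ (Matrix n) λ F → Σ (Matrix n) λ G → Σ (Matrix n) λ H →
    InN A (A ⁽⁻⁾) F × InN A B G × InN A B H ×
    Σ (Matrix n) λ K →
    Σ (Matrix n) λ ΘH → Σ (Matrix n) λ ΘKᵀ →
    IsΘ A B H ΘH × IsΘ A (B ᵀ) (K ᵀ) ΘKᵀ × (ΘH ≈m (ΘKᵀ ᵀ)) ×
    Σ (Matrix n) λ T₁ → Σ (Matrix n) λ T₂ →
    Σ (Matrix n) λ T₃ → Σ (Matrix n) λ T₄ →
    IsΘ A (A ⁽⁻⁾) F T₁ × IsΘ A B G T₂ × IsΘ A B (G ᵀ) T₃ ×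
    IsΘ (B ⁽⁻⁾) ((B ⁽⁻⁾) ⁽⁻⁾) F T₄ ×
    (N ≈b blocks T₁ T₂ T₃ T₄ H K)

{-# OPTIONS --safe #-}
-- J₄ₙ = 𝓜(I, I, O) for every pair (A, B), since Θ(I) = J and H = O is paired with K = O.
-- I₄ₙ = 𝓜(J/2n, O, I/2) with K = I/2, because Θ_A(J/n) = Θ_{B⁽⁻⁾}(J/n) = I as soon as Aᵀ and
-- (B⁽⁻⁾)ᵀ are type II; the work is to derive this from the Jones pair axioms.
-- Let Dₗ be the diagonal matrix of the l-th column of B (or of Bᵀ). The braid relation, applied
-- to a matrix with constant columns, gives A Dₗ A = Dₗ A Dₗ, i.e. A Dₗ A⁻¹ = Dₗ⁻¹ A Dₗ. Comparing
-- traces, every column sum of B and of Bᵀ equals trace A; summing A Dₗ A⁻¹ over l then gives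
-- A ∘ (B B⁽⁻⁾ᵀ)ᵀ = (trace A) I, so B and Bᵀ are type II, and then so is (B⁽⁻⁾)ᵀ = (Bᵀ)⁽⁻⁾.
-- Weighting the diagonal entries (A Dₗ A⁻¹)ⱼⱼ = Aⱼⱼ by B⁻¹ₘₗ and summing over l shows that
-- A⁻¹ ∘ Aᵀ has constant rows, i.e. A⁻¹ is a diagonal matrix times (A⁽⁻⁾)ᵀ; hence Aᵀ is type II.
module Submission where

open import Defs
open import Level using (_⊔_)
open import Data.Nat using (ℕ; zero; suc)
open import Data.Fin using (Fin; zero; suc; _≟_; punchIn)
open import Data.Fin.Properties using (punchInᵢ≢i)
open import Data.Product using (_×_; _,_; proj₁; proj₂)
open import Data.Empty using (⊥-elim)
open import Relation.Nullary using (¬_; yes; no)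
open import Relation.Binary.PropositionalEquality as ≡ using (_≡_; _≢_)
open import Algebra.Bundles using (CommutativeRing)

module FieldProperties {c ℓ} (F : Field c ℓ) where
  open Field F
  open CommutativeRing commutativeRing
    using (sym; trans; *-comm; *-assoc; *-identityˡ; zeroʳ; *-congˡ; *-congʳ)
  open import Relation.Binary.Reasoning.Setoid setoid

  x⁻¹*x≈1 : ∀ {x} → ¬ x ≈ 0# → x ⁻¹ * x ≈ 1#
  x⁻¹*x≈1 {x} x≉0 = trans (*-comm _ _) (⁻¹-inverse x x≉0)

  *-cancelˡ : ∀ {a x y} → ¬ a ≈ 0# → a * x ≈ a * y → x ≈ y
  *-cancelˡ {a} {x} {y} a≉0 ax≈ay = begin
    x                ≈⟨ sym (*-identityˡ x) ⟩
    1# * x           ≈⟨ *-congʳ (sym (x⁻¹*x≈1 a≉0)) ⟩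
    (a ⁻¹ * a) * x   ≈⟨ *-assoc _ _ _ ⟩
    a ⁻¹ * (a * x)   ≈⟨ *-congˡ ax≈ay ⟩
    a ⁻¹ * (a * y)   ≈⟨ *-assoc _ _ _ ⟨
    (a ⁻¹ * a) * y   ≈⟨ *-congʳ (x⁻¹*x≈1 a≉0) ⟩
    1# * y           ≈⟨ *-identityˡ y ⟩
    y                ∎

  x*y≈0⇒y≈0 : ∀ {x y} → ¬ x ≈ 0# → x * y ≈ 0# → y ≈ 0#
  x*y≈0⇒y≈0 {x} x≉0 xy≈0 = *-cancelˡ x≉0 (trans xy≈0 (sym (zeroʳ x)))

  *-nonzero : ∀ {x y} → ¬ x ≈ 0# → ¬ y ≈ 0# → ¬ x * y ≈ 0#
  *-nonzero x≉0 y≉0 xy≈0 = y≉0 (x*y≈0⇒y≈0 x≉0 xy≈0)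

  ⁻¹-nonzero : ∀ {x} → ¬ x ≈ 0# → ¬ x ⁻¹ ≈ 0#
  ⁻¹-nonzero {x} x≉0 x⁻¹≈0 = 0≉1 (begin
    0#         ≈⟨ zeroʳ x ⟨
    x * 0#     ≈⟨ *-congˡ x⁻¹≈0 ⟨
    x * x ⁻¹   ≈⟨ ⁻¹-inverse x x≉0 ⟩
    1#         ∎)

  ⁻¹-involutive : ∀ {x} → ¬ x ≈ 0# → x ⁻¹ ⁻¹ ≈ x
  ⁻¹-involutive {x} x≉0 = *-cancelˡ (⁻¹-nonzero x≉0)
    (trans (⁻¹-inverse (x ⁻¹) (⁻¹-nonzero x≉0)) (sym (x⁻¹*x≈1 x≉0)))

module SumProperties {c ℓ} (F : Field c ℓ) where
  open Field F
  open CommutativeRing commutativeRing using (semiring; +-congˡ; +-identityʳ)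
  open import Algebra.Properties.Semiring.Sum semiring as Sum using (sum)
  open import Relation.Binary.Reasoning.Setoid setoid

  ∑≡sum : ∀ {m} (f : Fin m → Carrier) → ∑ f ≡ sum f
  ∑≡sum {zero}  f = ≡.refl
  ∑≡sum {suc m} f = ≡.cong (f zero +_) (∑≡sum (λ i → f (suc i)))

  ∑-cong : ∀ {m} {f g : Fin m → Carrier} → (∀ i → f i ≈ g i) → ∑ f ≈ ∑ g
  ∑-cong {f = f} {g} f≈g = begin
    ∑ f    ≡⟨ ∑≡sum f ⟩
    sum f  ≈⟨ Sum.sum-cong-≋ {x = f} {y = g} f≈g ⟩
    sum g  ≡⟨ ∑≡sum g ⟨
    ∑ g    ∎

  ∑-zero : ∀ {m} {f : Fin m → Carrier} → (∀ i → f i ≈ 0#) → ∑ f ≈ 0#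
  ∑-zero {m} {f} f≈0 = begin
    ∑ f                 ≈⟨ ∑-cong f≈0 ⟩
    ∑ {m} (λ _ → 0#)    ≡⟨ ∑≡sum {m} (λ _ → 0#) ⟩
    sum {m} (λ _ → 0#)  ≈⟨ Sum.sum-replicate-zero m ⟩
    0#                  ∎

  ∑-one : ∀ {m} → ∑ {m} (λ _ → 1#) ≡ natCast m
  ∑-one {zero}  = ≡.refl
  ∑-one {suc m} = ≡.cong (1# +_) (∑-one {m})

  ∑-comm : ∀ {m p} (f : Fin m → Fin p → Carrier) →
           ∑ (λ i → ∑ (λ j → f i j)) ≈ ∑ (λ j → ∑ (λ i → f i j))
  ∑-comm f = begin
    ∑ (λ i → ∑ (λ j → f i j))      ≡⟨ ∑∑≡sum-sum f ⟩
    sum (λ i → sum (λ j → f i j))  ≈⟨ Sum.∑-comm f ⟩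
    sum (λ j → sum (λ i → f i j))  ≡⟨ ∑∑≡sum-sum (λ j i → f i j) ⟨
    ∑ (λ j → ∑ (λ i → f i j))      ∎
    where
    ∑∑≡sum-sum : ∀ {m p} (g : Fin m → Fin p → Carrier) →
                 ∑ (λ i → ∑ (λ j → g i j)) ≡ sum (λ i → sum (λ j → g i j))
    ∑∑≡sum-sum g = ≡.trans (∑≡sum (λ i → ∑ (g i))) (Sum.sum-cong-≗ (λ i → ∑≡sum (g i)))

  *-distribˡ-∑ : ∀ {m} a (f : Fin m → Carrier) → a * ∑ f ≈ ∑ (λ i → a * f i)
  *-distribˡ-∑ a f = begin
    a * ∑ f                ≡⟨ ≡.cong (a *_) (∑≡sum f) ⟩
    a * sum f              ≈⟨ Sum.*-distribˡ-sum a f ⟩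
    sum (λ i → a * f i)    ≡⟨ ∑≡sum (λ i → a * f i) ⟨
    ∑ (λ i → a * f i)      ∎

  *-distribʳ-∑ : ∀ {m} a (f : Fin m → Carrier) → ∑ f * a ≈ ∑ (λ i → f i * a)
  *-distribʳ-∑ a f = begin
    ∑ f * a                ≡⟨ ≡.cong (_* a) (∑≡sum f) ⟩
    sum f * a              ≈⟨ Sum.*-distribʳ-sum a f ⟩
    sum (λ i → f i * a)    ≡⟨ ∑≡sum (λ i → f i * a) ⟨
    ∑ (λ i → f i * a)      ∎

  ∑-pick : ∀ {m} {f : Fin m → Carrier} j → (∀ k → k ≢ j → f k ≈ 0#) → ∑ f ≈ f j
  ∑-pick {suc m} {f} j others≈0 = begin
    ∑ f                               ≡⟨ ∑≡sum f ⟩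
    sum f                             ≈⟨ Sum.sum-remove {i = j} f ⟩
    f j + sum (λ k → f (punchIn j k)) ≡⟨ ≡.cong (f j +_) (∑≡sum (λ k → f (punchIn j k))) ⟨
    f j + ∑ (λ k → f (punchIn j k))   ≈⟨ +-congˡ (∑-zero (λ k → others≈0 _ (punchInᵢ≢i j k))) ⟩
    f j + 0#                          ≈⟨ +-identityʳ (f j) ⟩
    f j                               ∎

module MatrixProperties {c ℓ} (K : ACF0 c ℓ) where
  open Theory K
  open CommutativeRing commutativeRing
    using (refl; sym; trans; *-comm; *-assoc; *-identityʳ; zeroˡ; zeroʳ; *-congˡ; *-congʳ; commutativeSemiring)
  open FieldProperties field′
  open SumProperties field′
  open import Relation.Binary.Reasoning.Setoid setoid
  open import Algebra.Solver.Ring.NaturalCoefficients.Default commutativeSemiring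

  δ-refl : ∀ {m} (i : Fin m) → δ i i ≈ 1#
  δ-refl i with i ≟ i
  ... | yes _   = refl
  ... | no i≢i  = ⊥-elim (i≢i ≡.refl)

  δ-≢ : ∀ {m} {i j : Fin m} → i ≢ j → δ i j ≈ 0#
  δ-≢ {i = i} {j} i≢j with i ≟ j
  ... | yes i≡j = ⊥-elim (i≢j i≡j)
  ... | no _    = refl

  δ-sym : ∀ {m} (i j : Fin m) → δ i j ≈ δ j i
  δ-sym i j with i ≟ j | j ≟ i
  ... | yes _   | yes _   = refl
  ... | no _    | no _    = refl
  ... | yes i≡j | no j≢i  = ⊥-elim (j≢i (≡.sym i≡j))
  ... | no i≢j  | yes j≡i = ⊥-elim (i≢j (≡.sym j≡i))

  ∑-*δ : ∀ {m} (f : Fin m → Carrier) j → ∑ (λ k → f k * δ k j) ≈ f j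
  ∑-*δ f j = trans (∑-pick j (λ k k≢j → trans (*-congˡ (δ-≢ k≢j)) (zeroʳ (f k))))
                   (trans (*-congˡ (δ-refl j)) (*-identityʳ (f j)))

  ∑-δ* : ∀ {m} (f : Fin m → Carrier) j → ∑ (λ k → δ j k * f k) ≈ f j
  ∑-δ* f j = trans (∑-cong (λ k → trans (*-comm (δ j k) (f k)) (*-congˡ (δ-sym j k)))) (∑-*δ f j)

  ∑-*-assoc : ∀ {m p} (x : Fin p → Carrier) (y : Fin p → Fin m → Carrier) (z : Fin m → Carrier) →
              ∑ (λ j → ∑ (λ k → x k * y k j) * z j) ≈ ∑ (λ k → x k * ∑ (λ j → y k j * z j))
  ∑-*-assoc x y z = begin
    ∑ (λ j → ∑ (λ k → x k * y k j) * z j)    ≈⟨ ∑-cong (λ j → *-distribʳ-∑ (z j) (λ k → x k * y k j)) ⟩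
    ∑ (λ j → ∑ (λ k → x k * y k j * z j))    ≈⟨ ∑-comm (λ j k → x k * y k j * z j) ⟩
    ∑ (λ k → ∑ (λ j → x k * y k j * z j))    ≈⟨ ∑-cong (λ k → ∑-cong (λ j → *-assoc (x k) (y k j) (z j))) ⟩
    ∑ (λ k → ∑ (λ j → x k * (y k j * z j)))  ≈⟨ ∑-cong (λ k → *-distribˡ-∑ (x k) (λ j → y k j * z j)) ⟨
    ∑ (λ k → x k * ∑ (λ j → y k j * z j))    ∎

  ·-assoc : ∀ {n} (L M N : Matrix n) → ((L · M) · N) ≈m (L · (M · N))
  ·-assoc L M N i j = ∑-*-assoc (L i) M (λ k → N k j)

  -- Cᵀ A = (A C)ᵀ = I by symmetry, so Cᵀ = (Cᵀ A) C = C.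
  symmetric-rightInverse⇒leftInverse : ∀ {n} {A C : Matrix n} → A ≈m (A ᵀ) → (A · C) ≈m I → (C · A) ≈m I
  symmetric-rightInverse⇒leftInverse {n} {A} {C} A≈Aᵀ A·C≈I i j = begin
    ∑ (λ k → C i k * A k j)  ≈⟨ ∑-cong (λ k → *-congʳ (C-symmetric i k)) ⟩
    ∑ (λ k → C k i * A k j)  ≈⟨ Cᵀ·A≈I i j ⟩
    δ i j                    ∎
    where
    Cᵀ·A≈I : ((C ᵀ) · A) ≈m I
    Cᵀ·A≈I i j = begin
      ∑ (λ k → C k i * A k j)  ≈⟨ ∑-cong (λ k → trans (*-congʳ (A≈Aᵀ j k)) (*-comm (A k j) (C k i))) ⟨
      ∑ (λ k → A j k * C k i)  ≈⟨ A·C≈I j i ⟩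
      δ j i                    ≈⟨ δ-sym j i ⟩
      δ i j                    ∎
    C-symmetric : C ≈m (C ᵀ)
    C-symmetric i j = begin
      C i j                                      ≈⟨ ∑-δ* (λ k → C k j) i ⟨
      ∑ (λ k → δ i k * C k j)                    ≈⟨ ∑-cong (λ k → *-congʳ (Cᵀ·A≈I i k)) ⟨
      ∑ (λ k → ∑ (λ p → C p i * A p k) * C k j)  ≈⟨ ·-assoc (C ᵀ) A C i j ⟩
      ∑ (λ p → C p i * ∑ (λ k → A p k * C k j))  ≈⟨ ∑-cong (λ p → *-congˡ (A·C≈I p j)) ⟩
      ∑ (λ p → C p i * δ p j)                    ≈⟨ ∑-*δ (λ p → C p i) j ⟩
      C j i                                      ∎

  typeII-intro : ∀ {n} {W : Matrix n} → NoZeroEntry W →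
                 (∀ i j → i ≢ j → ∑ (λ k → W i k * W j k ⁻¹) ≈ 0#) → TypeII W
  typeII-intro {n} {W} W≉0 orthogonal = W≉0 , W·W⁽⁻⁾ᵀ≈nI
    where
    W·W⁽⁻⁾ᵀ≈nI : (W · ((W ⁽⁻⁾) ᵀ)) ≈m (natCast n *m I)
    W·W⁽⁻⁾ᵀ≈nI i j with i ≟ j
    ... | yes ≡.refl = begin
      ∑ (λ k → W i k * W i k ⁻¹)  ≈⟨ ∑-cong (λ k → ⁻¹-inverse (W i k) (W≉0 i k)) ⟩
      ∑ {n} (λ _ → 1#)            ≡⟨ ∑-one {n} ⟩
      natCast n                   ≈⟨ *-identityʳ (natCast n) ⟨
      natCast n * 1#              ∎
    ... | no i≢j = trans (orthogonal i j i≢j) (sym (zeroʳ (natCast n)))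

  typeII-⁽⁻⁾ : ∀ {n} {W : Matrix n} → TypeII W → TypeII (W ⁽⁻⁾)
  typeII-⁽⁻⁾ {n} {W} (W≉0 , W·W⁽⁻⁾ᵀ≈nI) =
    typeII-intro (λ i j → ⁻¹-nonzero (W≉0 i j)) orthogonal
    where
    orthogonal : ∀ i j → i ≢ j → ∑ (λ k → W i k ⁻¹ * W j k ⁻¹ ⁻¹) ≈ 0#
    orthogonal i j i≢j = begin
      ∑ (λ k → W i k ⁻¹ * W j k ⁻¹ ⁻¹)  ≈⟨ ∑-cong (λ k → trans (*-congˡ (⁻¹-involutive (W≉0 j k))) (*-comm _ _)) ⟩
      ∑ (λ k → W j k * W i k ⁻¹)        ≈⟨ W·W⁽⁻⁾ᵀ≈nI j i ⟩
      natCast n * δ j i                 ≈⟨ *-congˡ (δ-≢ (≡.≢-sym i≢j)) ⟩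
      natCast n * 0#                    ≈⟨ zeroʳ (natCast n) ⟩
      0#                                ∎

  natCast≉0 : ∀ {n} → Fin n → ¬ natCast n ≈ 0#
  natCast≉0 {suc n} _ = char0 n

  inverse-row-constant⇒typeIIᵀ : ∀ {n} {A C : Matrix n} → NoZeroEntry A → (C · A) ≈m I →
                                (∀ m j → C m j * A j m ≈ C m m * A m m) → TypeII (A ᵀ)
  inverse-row-constant⇒typeIIᵀ {n} {A} {C} A≉0 C·A≈I row-constant = typeII-intro (λ i j → A≉0 j i) orthogonal
    where
    γ : Fin n → Carrier
    γ m = C m m * A m m

    γ*A⁽⁻⁾ᵀ·A≈I : ∀ m k → γ m * ∑ (λ j → A j k * A j m ⁻¹) ≈ δ m k
    γ*A⁽⁻⁾ᵀ·A≈I m k = begin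
      γ m * ∑ (λ j → A j k * A j m ⁻¹)              ≈⟨ *-distribˡ-∑ (γ m) (λ j → A j k * A j m ⁻¹) ⟩
      ∑ (λ j → γ m * (A j k * A j m ⁻¹))            ≈⟨ ∑-cong (λ j → *-congʳ (row-constant m j)) ⟨
      ∑ (λ j → C m j * A j m * (A j k * A j m ⁻¹))  ≈⟨ ∑-cong (λ j → solve 4 (λ x a b u → x :* a :* (b :* u) := x :* b :* (a :* u))
                                                                             refl (C m j) (A j m) (A j k) (A j m ⁻¹)) ⟩
      ∑ (λ j → C m j * A j k * (A j m * A j m ⁻¹))  ≈⟨ ∑-cong (λ j → trans (*-congˡ (⁻¹-inverse (A j m) (A≉0 j m))) (*-identityʳ (C m j * A j k))) ⟩
      ∑ (λ j → C m j * A j k)                       ≈⟨ C·A≈I m k ⟩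
      δ m k                                         ∎

    γ≉0 : ∀ m → ¬ γ m ≈ 0#
    γ≉0 m γₘ≈0 = 0≉1 (begin
      0#                                  ≈⟨ zeroˡ (∑ (λ j → A j m * A j m ⁻¹)) ⟨
      0# * ∑ (λ j → A j m * A j m ⁻¹)     ≈⟨ *-congʳ γₘ≈0 ⟨
      γ m * ∑ (λ j → A j m * A j m ⁻¹)    ≈⟨ γ*A⁽⁻⁾ᵀ·A≈I m m ⟩
      δ m m                               ≈⟨ δ-refl m ⟩
      1#                                  ∎)

    orthogonal : ∀ i j → i ≢ j → ∑ (λ k → A k i * A k j ⁻¹) ≈ 0#
    orthogonal i j i≢j = x*y≈0⇒y≈0 (γ≉0 j) (trans (γ*A⁽⁻⁾ᵀ·A≈I j i) (δ-≢ (≡.≢-sym i≢j)))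

  Δ-invertible⇒noZeroEntry : ∀ {n} {W : Matrix n} → InvertibleMap (Δ W) → NoZeroEntry W
  Δ-invertible⇒noZeroEntry {W = W} (Δ⁻¹ , Δ∘Δ⁻¹≈id , _) i j Wᵢⱼ≈0 = 0≉1 (begin
    0#                       ≈⟨ zeroˡ (Δ⁻¹ J i j) ⟨
    0# * Δ⁻¹ J i j           ≈⟨ *-congʳ Wᵢⱼ≈0 ⟨
    W i j * Δ⁻¹ J i j        ≈⟨ Δ∘Δ⁻¹≈id J i j ⟩
    1#                       ∎)

module ThetaProperties {c ℓ} (K : ACF0 c ℓ) where
  open Theory K
  open CommutativeRing commutativeRing
    using (refl; sym; trans; *-assoc; *-identityˡ; zeroˡ; *-congˡ; *-congʳ;
           +-congˡ; +-identityʳ; -‿inverseʳ; distribʳ; ring; commutativeSemiring)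
  open import Algebra.Properties.Ring ring using (-0#≈0#)
  open FieldProperties field′
  open SumProperties field′
  open MatrixProperties K
  open import Relation.Binary.Reasoning.Setoid setoid
  open import Algebra.Solver.Ring.NaturalCoefficients.Default commutativeSemiring

  IsΘ-cong : ∀ {n} {P Q M M′ T T′ : Matrix n} → M ≈m M′ → T ≈m T′ → IsΘ P Q M T → IsΘ P Q M′ T′
  IsΘ-cong M≈M′ T≈T′ θ i j p =
    trans (∑-cong (λ k → *-congʳ (sym (M≈M′ p k)))) (trans (θ i j p) (*-congʳ (T≈T′ i j)))

  IsΘ⇒InN : ∀ {n} {P Q M T : Matrix n} → IsΘ P Q M T → InN P Q M
  IsΘ⇒InN {T = T} θ i j = T i j , θ i j

  IsΘ-O : ∀ {n} (P Q : Matrix n) → IsΘ P Q O O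
  IsΘ-O P Q i j p = trans (∑-zero (λ k → zeroˡ (eig P Q i j k))) (sym (zeroˡ (eig P Q i j p)))

  IsΘ-I : ∀ {n} (P Q : Matrix n) → IsΘ P Q I J
  IsΘ-I P Q i j p = trans (∑-δ* (eig P Q i j) p) (sym (*-identityˡ _))

  IsΘ-*m : ∀ {n} {P Q M T : Matrix n} a → IsΘ P Q M T → IsΘ P Q (a *m M) (a *m T)
  IsΘ-*m {n} {P} {Q} {M} {T} a θ i j p = begin
    ∑ (λ k → a * M p k * v k)    ≈⟨ ∑-cong (λ k → *-assoc a (M p k) (v k)) ⟩
    ∑ (λ k → a * (M p k * v k))  ≈⟨ *-distribˡ-∑ a (λ k → M p k * v k) ⟨
    a * ∑ (λ k → M p k * v k)    ≈⟨ *-congˡ (θ i j p) ⟩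
    a * (T i j * v p)            ≈⟨ *-assoc a (T i j) (v p) ⟨
    a * T i j * v p              ∎
    where
    v : Vector n
    v = eig P Q i j

  -- Pᵀ being type II says that the entries of P eᵢ ∘ P⁽⁻⁾ eⱼ sum to n δᵢⱼ; and P eᵢ ∘ P⁽⁻⁾ eᵢ is the all-ones vector.
  IsΘ-J/n : ∀ {n} {P : Matrix n} → TypeII (P ᵀ) → IsΘ P (P ⁽⁻⁾) ((natCast n ⁻¹) *m J) I
  IsΘ-J/n {n} {P} (Pᵀ≉0 , Pᵀ·P⁽⁻⁾≈nI) i j p = begin
    ∑ (λ k → natCast n ⁻¹ * 1# * (P k i * P k j ⁻¹))  ≈⟨ ∑-cong (λ k → trans (*-assoc _ 1# _) (*-congˡ (*-identityˡ (P k i * P k j ⁻¹)))) ⟩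
    ∑ (λ k → natCast n ⁻¹ * (P k i * P k j ⁻¹))       ≈⟨ *-distribˡ-∑ (natCast n ⁻¹) (λ k → P k i * P k j ⁻¹) ⟨
    natCast n ⁻¹ * ∑ (λ k → P k i * P k j ⁻¹)         ≈⟨ *-congˡ (Pᵀ·P⁽⁻⁾≈nI i j) ⟩
    natCast n ⁻¹ * (natCast n * δ i j)                ≈⟨ *-assoc _ _ _ ⟨
    natCast n ⁻¹ * natCast n * δ i j                  ≈⟨ *-congʳ (x⁻¹*x≈1 (natCast≉0 i)) ⟩
    1# * δ i j                                        ≈⟨ *-identityˡ (δ i j) ⟩
    δ i j                                             ≈⟨ δ≈δ*eig ⟩
    δ i j * (P p i * P p j ⁻¹)                        ∎
    where
    δ≈δ*eig : δ i j ≈ δ i j * (P p i * P p j ⁻¹)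
    δ≈δ*eig with i ≟ j
    ... | yes ≡.refl = sym (trans (*-identityˡ _) (⁻¹-inverse (P p i) (Pᵀ≉0 i p)))
    ... | no _       = sym (zeroˡ _)

  ½ : Carrier
  ½ = natCast 2 ⁻¹

  ½+½≈1 : ½ + ½ ≈ 1#
  ½+½≈1 = trans (solve 1 (λ h → h :+ h := (con 1 :+ (con 1 :+ con 0)) :* h) refl ½)
                (⁻¹-inverse (natCast 2) (char0 1))

  I≈½I+½I : ∀ {n} → _≈m_ {n} I ((½ *m I) +m (½ *m I))
  I≈½I+½I i j = sym (trans (sym (distribʳ (δ i j) ½ ½)) (trans (*-congʳ ½+½≈1) (*-identityˡ (δ i j))))

  O≈½I-½I : ∀ {n} → _≈m_ {n} O ((½ *m I) -m (½ *m I))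
  O≈½I-½I i j = sym (-‿inverseʳ (½ * δ i j))

  J≈J+O : ∀ {n} → _≈m_ {n} J (J +m O)
  J≈J+O _ _ = sym (+-identityʳ 1#)

  J≈J-O : ∀ {n} → _≈m_ {n} J (J -m O)
  J≈J-O _ _ = sym (trans (+-congˡ -0#≈0#) (+-identityʳ 1#))

  I₄ₙ≈blocks : ∀ {n} → I₄ₙ {n} ≈b blocks (½ *m I) O O (½ *m I) (½ *m I) (½ *m I)
  I₄ₙ≈blocks zero                   zero                   = I≈½I+½I
  I₄ₙ≈blocks zero                   (suc zero)             = O≈½I-½I
  I₄ₙ≈blocks zero                   (suc (suc _))          = λ _ _ → refl
  I₄ₙ≈blocks (suc zero)             zero                   = O≈½I-½I
  I₄ₙ≈blocks (suc zero)             (suc zero)             = I≈½I+½I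
  I₄ₙ≈blocks (suc zero)             (suc (suc _))          = λ _ _ → refl
  I₄ₙ≈blocks (suc (suc _))          zero                   = λ _ _ → refl
  I₄ₙ≈blocks (suc (suc _))          (suc zero)             = λ _ _ → refl
  I₄ₙ≈blocks (suc (suc zero))       (suc (suc zero))       = I≈½I+½I
  I₄ₙ≈blocks (suc (suc zero))       (suc (suc (suc zero))) = O≈½I-½I
  I₄ₙ≈blocks (suc (suc (suc zero))) (suc (suc zero))       = O≈½I-½I
  I₄ₙ≈blocks (suc (suc (suc zero))) (suc (suc (suc zero))) = I≈½I+½I

  J₄ₙ≈blocks : ∀ {n} → J₄ₙ {n} ≈b blocks J J J J O O
  J₄ₙ≈blocks zero                   zero                   = J≈J+O
  J₄ₙ≈blocks zero                   (suc zero)             = J≈J-O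
  J₄ₙ≈blocks zero                   (suc (suc _))          = λ _ _ → refl
  J₄ₙ≈blocks (suc zero)             zero                   = J≈J-O
  J₄ₙ≈blocks (suc zero)             (suc zero)             = J≈J+O
  J₄ₙ≈blocks (suc zero)             (suc (suc _))          = λ _ _ → refl
  J₄ₙ≈blocks (suc (suc _))          zero                   = λ _ _ → refl
  J₄ₙ≈blocks (suc (suc _))          (suc zero)             = λ _ _ → refl
  J₄ₙ≈blocks (suc (suc zero))       (suc (suc zero))       = J≈J+O
  J₄ₙ≈blocks (suc (suc zero))       (suc (suc (suc zero))) = J≈J-O
  J₄ₙ≈blocks (suc (suc (suc zero))) (suc (suc zero))       = J≈J-O
  J₄ₙ≈blocks (suc (suc (suc zero))) (suc (suc (suc zero))) = J≈J+O

  J₄ₙ∈ℬ : ∀ {n} (A B : Matrix n) → Inℬ A B J₄ₙ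
  J₄ₙ∈ℬ A B =
    I , I , O , IsΘ⇒InN (IsΘ-I A (A ⁽⁻⁾)) , IsΘ⇒InN (IsΘ-I A B) , IsΘ⇒InN (IsΘ-O A B) ,
    O , O , O , IsΘ-O A B , IsΘ-O A (B ᵀ) , (λ _ _ → refl) ,
    J , J , J , J , IsΘ-I A (A ⁽⁻⁾) , IsΘ-I A B , IsΘ-cong δ-sym (λ _ _ → refl) (IsΘ-I A B) ,
    IsΘ-I (B ⁽⁻⁾) (B ⁽⁻⁾ ⁽⁻⁾) ,
    J₄ₙ≈blocks

  I₄ₙ∈ℬ : ∀ {n} {A B : Matrix n} → TypeII (A ᵀ) → TypeII ((B ⁽⁻⁾) ᵀ) → Inℬ A B I₄ₙ
  I₄ₙ∈ℬ {n} {A} {B} Aᵀ-typeII B⁽⁻⁾ᵀ-typeII =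
    F , O , ½ *m I , IsΘ⇒InN ΘA[F] , IsΘ⇒InN (IsΘ-O A B) , IsΘ⇒InN (IsΘ-*m ½ (IsΘ-I A B)) ,
    ½ *m I , ½ *m J , ½ *m J , IsΘ-*m ½ (IsΘ-I A B) ,
    IsΘ-cong (λ i j → *-congˡ (δ-sym i j)) (λ _ _ → refl) (IsΘ-*m ½ (IsΘ-I A (B ᵀ))) , (λ _ _ → refl) ,
    ½ *m I , O , O , ½ *m I , ΘA[F] , IsΘ-O A B , IsΘ-O A B , IsΘ-*m ½ (IsΘ-J/n B⁽⁻⁾ᵀ-typeII) ,
    I₄ₙ≈blocks
    where
    F : Matrix n
    F = ½ *m ((natCast n ⁻¹) *m J)
    ΘA[F] : IsΘ A (A ⁽⁻⁾) F (½ *m I)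
    ΘA[F] = IsΘ-*m ½ (IsΘ-J/n Aᵀ-typeII)

module JonesPairProperties {c ℓ} (K : ACF0 c ℓ) where
  open Theory K
  open CommutativeRing commutativeRing
    using (refl; sym; trans; *-comm; *-assoc; *-identityʳ; zeroʳ; *-congˡ; *-congʳ; commutativeSemiring)
  open FieldProperties field′
  open SumProperties field′
  open MatrixProperties K
  open import Relation.Binary.Reasoning.Setoid setoid
  open import Algebra.Solver.Ring.NaturalCoefficients.Default commutativeSemiring

  trace : ∀ {n} → Matrix n → Carrier
  trace A = ∑ (λ i → A i i)

  Braid : ∀ {n} → Matrix n → Matrix n → Set (c ⊔ ℓ)
  Braid A W = ∀ M → X A (Δ W (X A M)) ≈m Δ W (X A (Δ W M))

  -- Dₗ = diag (W eₗ); apply the braid relation to the matrix all of whose columns are eⱼ.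
  braid⇒ADA≈DAD : ∀ {n} {A W : Matrix n} → Braid A W →
                  ∀ i j l → ∑ (λ k → A i k * (W k l * A k j)) ≈ W i l * (A i j * W j l)
  braid⇒ADA≈DAD {A = A} {W} braid i j l = begin
    ∑ (λ k → A i k * (W k l * A k j))                    ≈⟨ ∑-cong (λ k → *-congˡ (*-congˡ (∑-*δ (A k) j))) ⟨
    ∑ (λ k → A i k * (W k l * ∑ (λ m → A k m * δ m j)))  ≈⟨ braid (λ m _ → δ m j) i l ⟩
    W i l * ∑ (λ k → A i k * (W k l * δ k j))            ≈⟨ *-congˡ (∑-cong (λ k → *-assoc (A i k) (W k l) (δ k j))) ⟨
    W i l * ∑ (λ k → A i k * W k l * δ k j)              ≈⟨ *-congˡ (∑-*δ (λ k → A i k * W k l) j) ⟩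
    W i l * (A i j * W j l)                               ∎

  module Braided {n} {A C W : Matrix n} (A·C≈I : (A · C) ≈m I) (W≉0 : NoZeroEntry W) (braid : Braid A W) where

    ADA⁻¹≈D⁻¹AD : ∀ i j l → ∑ (λ m → A i m * (W m l * C m j)) ≈ A i j * (W j l * W i l ⁻¹)
    ADA⁻¹≈D⁻¹AD i j l = *-cancelˡ (W≉0 i l) (begin
      W i l * ∑ (λ m → A i m * (W m l * C m j))            ≈⟨ *-distribˡ-∑ (W i l) (λ m → A i m * (W m l * C m j)) ⟩
      ∑ (λ m → W i l * (A i m * (W m l * C m j)))          ≈⟨ ∑-cong (λ m → solve 4 (λ w a v x → w :* (a :* (v :* x)) := w :* (a :* v) :* x)
                                                                                    refl (W i l) (A i m) (W m l) (C m j)) ⟩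
      ∑ (λ m → W i l * (A i m * W m l) * C m j)            ≈⟨ ∑-cong (λ m → *-congʳ (braid⇒ADA≈DAD braid i m l)) ⟨
      ∑ (λ m → ∑ (λ k → A i k * (W k l * A k m)) * C m j)  ≈⟨ ∑-cong (λ m → *-congʳ (∑-cong (λ k → *-assoc (A i k) (W k l) (A k m)))) ⟨
      ∑ (λ m → ∑ (λ k → A i k * W k l * A k m) * C m j)    ≈⟨ ∑-*-assoc (λ k → A i k * W k l) A (λ m → C m j) ⟩
      ∑ (λ k → A i k * W k l * ∑ (λ m → A k m * C m j))    ≈⟨ ∑-cong (λ k → *-congˡ (A·C≈I k j)) ⟩
      ∑ (λ k → A i k * W k l * δ k j)                      ≈⟨ ∑-*δ (λ k → A i k * W k l) j ⟩
      A i j * W j l                                        ≈⟨ *-identityʳ (A i j * W j l) ⟨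
      A i j * W j l * 1#                                   ≈⟨ *-congˡ (⁻¹-inverse (W i l) (W≉0 i l)) ⟨
      A i j * W j l * (W i l * W i l ⁻¹)                   ≈⟨ solve 4 (λ a v w u → a :* v :* (w :* u) := w :* (a :* (v :* u)))
                                                                      refl (A i j) (W j l) (W i l) (W i l ⁻¹) ⟩
      W i l * (A i j * (W j l * W i l ⁻¹))                 ∎)

    ADA⁻¹-diagonal : ∀ i l → ∑ (λ m → A i m * (W m l * C m i)) ≈ A i i
    ADA⁻¹-diagonal i l = trans (ADA⁻¹≈D⁻¹AD i i l) (trans (*-congˡ (⁻¹-inverse (W i l) (W≉0 i l))) (*-identityʳ (A i i)))

    -- trace (A Dₗ A⁻¹) = trace Dₗ.
    column-sum≈trace : (C · A) ≈m I → ∀ l → ∑ (λ m → W m l) ≈ trace A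
    column-sum≈trace C·A≈I l = sym (begin
      ∑ (λ i → A i i)                                  ≈⟨ ∑-cong (λ i → ADA⁻¹-diagonal i l) ⟨
      ∑ (λ i → ∑ (λ m → A i m * (W m l * C m i)))      ≈⟨ ∑-comm (λ i m → A i m * (W m l * C m i)) ⟩
      ∑ (λ m → ∑ (λ i → A i m * (W m l * C m i)))      ≈⟨ ∑-cong (λ m → ∑-cong (λ i → solve 3 (λ a w x → a :* (w :* x) := w :* (x :* a))
                                                                                              refl (A i m) (W m l) (C m i))) ⟩
      ∑ (λ m → ∑ (λ i → W m l * (C m i * A i m)))      ≈⟨ ∑-cong (λ m → *-distribˡ-∑ (W m l) (λ i → C m i * A i m)) ⟨
      ∑ (λ m → W m l * ∑ (λ i → C m i * A i m))        ≈⟨ ∑-cong (λ m → *-congˡ (trans (C·A≈I m m) (δ-refl m))) ⟩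
      ∑ (λ m → W m l * 1#)                             ≈⟨ ∑-cong (λ m → *-identityʳ (W m l)) ⟩
      ∑ (λ m → W m l)                                  ∎)

    module _ (row-sum≈trace : ∀ m → ∑ (λ l → W m l) ≈ trace A) where

      -- ∑ₗ A Dₗ A⁻¹ = A diag (W 𝟙) A⁻¹ = (trace A) I.
      A∘[W·W⁽⁻⁾ᵀ]ᵀ≈trace·I : ∀ i j → A i j * ∑ (λ l → W j l * W i l ⁻¹) ≈ trace A * δ i j
      A∘[W·W⁽⁻⁾ᵀ]ᵀ≈trace·I i j = begin
        A i j * ∑ (λ l → W j l * W i l ⁻¹)             ≈⟨ *-distribˡ-∑ (A i j) (λ l → W j l * W i l ⁻¹) ⟩
        ∑ (λ l → A i j * (W j l * W i l ⁻¹))           ≈⟨ ∑-cong (λ l → ADA⁻¹≈D⁻¹AD i j l) ⟨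
        ∑ (λ l → ∑ (λ m → A i m * (W m l * C m j)))    ≈⟨ ∑-comm (λ l m → A i m * (W m l * C m j)) ⟩
        ∑ (λ m → ∑ (λ l → A i m * (W m l * C m j)))    ≈⟨ ∑-cong (λ m → ∑-cong (λ l → solve 3 (λ a w x → a :* (w :* x) := a :* x :* w)
                                                                                              refl (A i m) (W m l) (C m j))) ⟩
        ∑ (λ m → ∑ (λ l → A i m * C m j * W m l))      ≈⟨ ∑-cong (λ m → *-distribˡ-∑ (A i m * C m j) (W m)) ⟨
        ∑ (λ m → A i m * C m j * ∑ (λ l → W m l))      ≈⟨ ∑-cong (λ m → *-congˡ (row-sum≈trace m)) ⟩
        ∑ (λ m → A i m * C m j * trace A)              ≈⟨ *-distribʳ-∑ (trace A) (λ m → A i m * C m j) ⟨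
        ∑ (λ m → A i m * C m j) * trace A              ≈⟨ *-congʳ (A·C≈I i j) ⟩
        δ i j * trace A                                ≈⟨ *-comm (δ i j) (trace A) ⟩
        trace A * δ i j                                ∎

      typeII : NoZeroEntry A → TypeII W
      typeII A≉0 = typeII-intro W≉0 λ i j i≢j →
        x*y≈0⇒y≈0 (A≉0 j i)
          (trans (A∘[W·W⁽⁻⁾ᵀ]ᵀ≈trace·I j i) (trans (*-congˡ (δ-≢ (≡.≢-sym i≢j))) (zeroʳ (trace A))))

      diagonal≈trace/n : ∀ i → A i i * natCast n ≈ trace A
      diagonal≈trace/n i = begin
        A i i * natCast n                        ≡⟨ ≡.cong (A i i *_) (∑-one {n}) ⟨
        A i i * ∑ {n} (λ _ → 1#)                 ≈⟨ *-congˡ (∑-cong (λ l → ⁻¹-inverse (W i l) (W≉0 i l))) ⟨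
        A i i * ∑ (λ l → W i l * W i l ⁻¹)       ≈⟨ A∘[W·W⁽⁻⁾ᵀ]ᵀ≈trace·I i i ⟩
        trace A * δ i i                          ≈⟨ *-congˡ (δ-refl i) ⟩
        trace A * 1#                             ≈⟨ *-identityʳ (trace A) ⟩
        trace A                                  ∎

    -- Weight (A Dₗ A⁻¹)ⱼⱼ = Aⱼⱼ by W⁻¹ₘₗ, sum over l and use W (W⁽⁻⁾)ᵀ = n I.
    diagonal*row-sum⁽⁻⁾ : TypeII W → ∀ j m → A j j * ∑ (λ l → W m l ⁻¹) ≈ natCast n * (C m j * A j m)
    diagonal*row-sum⁽⁻⁾ (_ , W·W⁽⁻⁾ᵀ≈nI) j m = begin
      A j j * ∑ (λ l → W m l ⁻¹)                                  ≈⟨ *-distribˡ-∑ (A j j) (λ l → W m l ⁻¹) ⟩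
      ∑ (λ l → A j j * W m l ⁻¹)                                  ≈⟨ ∑-cong (λ l → *-congʳ (ADA⁻¹-diagonal j l)) ⟨
      ∑ (λ l → ∑ (λ k → A j k * (W k l * C k j)) * W m l ⁻¹)      ≈⟨ ∑-cong (λ l → *-distribʳ-∑ (W m l ⁻¹) (λ k → A j k * (W k l * C k j))) ⟩
      ∑ (λ l → ∑ (λ k → A j k * (W k l * C k j) * W m l ⁻¹))      ≈⟨ ∑-comm (λ l k → A j k * (W k l * C k j) * W m l ⁻¹) ⟩
      ∑ (λ k → ∑ (λ l → A j k * (W k l * C k j) * W m l ⁻¹))      ≈⟨ ∑-cong (λ k → ∑-cong (λ l → solve 4 (λ a w x u → a :* (w :* x) :* u := x :* a :* (w :* u))
                                                                                                         refl (A j k) (W k l) (C k j) (W m l ⁻¹))) ⟩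
      ∑ (λ k → ∑ (λ l → C k j * A j k * (W k l * W m l ⁻¹)))      ≈⟨ ∑-cong (λ k → *-distribˡ-∑ (C k j * A j k) (λ l → W k l * W m l ⁻¹)) ⟨
      ∑ (λ k → C k j * A j k * ∑ (λ l → W k l * W m l ⁻¹))        ≈⟨ ∑-cong (λ k → *-congˡ (W·W⁽⁻⁾ᵀ≈nI k m)) ⟩
      ∑ (λ k → C k j * A j k * (natCast n * δ k m))                ≈⟨ ∑-cong (λ k → solve 3 (λ x nn d → x :* (nn :* d) := nn :* x :* d)
                                                                                            refl (C k j * A j k) (natCast n) (δ k m)) ⟩
      ∑ (λ k → natCast n * (C k j * A j k) * δ k m)                ≈⟨ ∑-*δ (λ k → natCast n * (C k j * A j k)) m ⟩
      natCast n * (C m j * A j m)                                 ∎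

  module _ {n} {A B : Matrix n} (ijp : InvertibleJonesPair A B) (A≈Aᵀ : A ≈m (A ᵀ)) where
    open InvertibleJonesPair ijp
    open JonesPair jonesPair

    private
      -- X_A being invertible only yields a right inverse C of A (the inverse map need not respect ≈m).
      C : Matrix n
      C = proj₁ X-inv I

      A·C≈I : (A · C) ≈m I
      A·C≈I = proj₁ (proj₂ X-inv) I

      C·A≈I : (C · A) ≈m I
      C·A≈I = symmetric-rightInverse⇒leftInverse A≈Aᵀ A·C≈I

      B≉0 : NoZeroEntry B
      B≉0 = Δ-invertible⇒noZeroEntry Δ-inv

      module B  = Braided A·C≈I B≉0 braid
      module Bᵀ = Braided A·C≈I (λ i j → B≉0 j i) braidᵀ

      row-sum≈trace : ∀ m → ∑ (λ l → B m l) ≈ trace A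
      row-sum≈trace = Bᵀ.column-sum≈trace C·A≈I

    B-typeII : TypeII B
    B-typeII = B.typeII row-sum≈trace A-noZero

    Bᵀ-typeII : TypeII (B ᵀ)
    Bᵀ-typeII = Bᵀ.typeII (B.column-sum≈trace C·A≈I) A-noZero

    Aᵀ-typeII : TypeII (A ᵀ)
    Aᵀ-typeII = inverse-row-constant⇒typeIIᵀ A-noZero C·A≈I row-constant
      where
      n²·C∘Aᵀ≈trace·s : ∀ m j → natCast n * natCast n * (C m j * A j m) ≈ trace A * ∑ (λ l → B m l ⁻¹)
      n²·C∘Aᵀ≈trace·s m j = begin
        natCast n * natCast n * (C m j * A j m)    ≈⟨ *-assoc (natCast n) (natCast n) (C m j * A j m) ⟩
        natCast n * (natCast n * (C m j * A j m))  ≈⟨ *-congˡ (B.diagonal*row-sum⁽⁻⁾ B-typeII j m) ⟨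
        natCast n * (A j j * s)                    ≈⟨ solve 3 (λ x a y → x :* (a :* y) := a :* x :* y) refl (natCast n) (A j j) s ⟩
        A j j * natCast n * s                      ≈⟨ *-congʳ (B.diagonal≈trace/n row-sum≈trace j) ⟩
        trace A * s                                ∎
        where
        s : Carrier
        s = ∑ (λ l → B m l ⁻¹)

      row-constant : ∀ m j → C m j * A j m ≈ C m m * A m m
      row-constant m j = *-cancelˡ (*-nonzero (natCast≉0 m) (natCast≉0 m))
                                   (trans (n²·C∘Aᵀ≈trace·s m j) (sym (n²·C∘Aᵀ≈trace·s m m)))

lemma6p3 : ∀ {c ℓ} (K : ACF0 c ℓ) (n : ℕ) (A B : Theory.Matrix K n) →
    Theory.InvertibleJonesPair K A B →
    Theory._≈m_ K A (Theory._ᵀ K A) →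
    Theory.Inℬ K A B (Theory.I₄ₙ K) × Theory.Inℬ K A B (Theory.J₄ₙ K)
lemma6p3 K n A B ijp A≈Aᵀ =
  I₄ₙ∈ℬ (Aᵀ-typeII ijp A≈Aᵀ) (typeII-⁽⁻⁾ (Bᵀ-typeII ijp A≈Aᵀ)) , J₄ₙ∈ℬ A B
  where
  open MatrixProperties K using (typeII-⁽⁻⁾)
  open ThetaProperties K using (I₄ₙ∈ℬ; J₄ₙ∈ℬ)
  open JonesPairProperties K using (Aᵀ-typeII; Bᵀ-typeII)
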